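{- Let $p\in\{2,3\}$, let $d>1$ be an integer, let $X$ be a set of $p^{d}-1$ points in $\mathbb{F}^n_p$ and let $f:X \rightarrow \mathbb{F}_p$ be an arbitrary function. Then there exists a polynomial $q$ of degree at most $(p-1)d$ (in $n$ variables over $\mathbb{F}_p$) such that $q(x)=f(x)$ for all $x\in X$.
   Context: $\mathbb{F}_p$ denotes the field with $p$ elements; polynomials are considered as functions $\mathbb{F}_p^n\to\mathbb{F}_p$ (so individual degrees may be taken at most $p-1$). -}

module Defs where

open import Data.Nat using (ℕ; zero; suc; _+_; _*_; _^_; _≤_; NonZero; _%_)
open import Data.Fin using (Fin; toℕ)
open import Data.Vec using (Vec; []; _∷_)
open import Data.List using (List; []; _∷_)
open import Data.List.Relation.Unary.All using (All)
open import Data.Product using (_×_; _,_)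
open import Relation.Binary.PropositionalEquality using (_≡_)

-- Elements of 𝔽_p are represented by Fin p (residues 0..p-1).
-- A point of 𝔽_p^n is a vector of n elements of 𝔽_p.
Point : ℕ → ℕ → Set
Point p n = Vec (Fin p) n

-- A monomial c · x₁^e₁ ⋯ xₙ^eₙ : coefficient in 𝔽_p and exponent vector.
Monomial : ℕ → ℕ → Set
Monomial p n = Fin p × Vec ℕ n

Poly : ℕ → ℕ → Set
Poly p n = List (Monomial p n)

monoDeg : ∀ {n} → Vec ℕ n → ℕ
monoDeg [] = 0
monoDeg (e ∷ es) = e + monoDeg es

DegLe : ∀ {p n} → Poly p n → ℕ → Set
DegLe q D = All (λ m → monoDeg (Data.Product.proj₂ m) ≤ D) q

monoValℕ : ∀ {p n} → Vec ℕ n → Point p n → ℕ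
monoValℕ [] [] = 1
monoValℕ (e ∷ es) (x ∷ xs) = toℕ x ^ e * monoValℕ es xs

-- value of the polynomial computed in ℕ (before reduction mod p)
evalℕ : ∀ {p n} → Poly p n → Point p n → ℕ
evalℕ [] x = 0
evalℕ ((c , e) ∷ q) x = toℕ c * monoValℕ e x + evalℕ q x

EvalEq : (p : ℕ) .{{_ : NonZero p}} → ∀ {n} → Poly p n → Point p n → Fin p → Set
EvalEq p q x y = evalℕ q x % p ≡ toℕ y

-- For each point Xᵢ we build a bump polynomial of degree (p-1)d that is 1 at Xᵢ and 0 at all other Xⱼ;
-- the interpolant is Σᵢ f(Xᵢ)·bumpᵢ. The bump is ∏ₗ (1 - (aₗ·(y - Xᵢ))^(p-1)) for d linear functionals
-- a₁ … a_d such that every difference Xⱼ - Xᵢ lies outside the kernel of some aₗ. These exist by double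
-- counting: a nonzero vector lies in the kernel of exactly p^(n-1) of the p^n functionals, so among fewer
-- than p^(k+1) nonzero vectors some functional annihilates fewer than p^k of them, and we recurse on those.
-- The only property of 𝔽ₚ used is Fermat's little theorem, which for p = 2, 3 is checked by enumeration.
module Submission where

open import Defs
open import Data.Nat using (ℕ; zero; suc; _+_; _∸_; _*_; _^_; _<_; _≤_; _%_; z≤n; s≤s; NonZero; >-nonZero⁻¹)
open import Data.Nat.Properties
open import Data.Nat.DivMod using (_mod_; %-distribˡ-+; %-distribˡ-*; %-remove-+ʳ; m%n%n≡m%n; m%n<n; m<n⇒m%n≡m; n%1≡0)
open import Data.Nat.Divisibility using (m∣m*n)
open import Data.Nat.Tactic.RingSolver using (solve-∀)
open import Algebra.Properties.Semiring.Sum +-*-semiring using (sum-syntax; sum-cong-≗; sum-remove; sum-replicate-zero; ∑-comm; ∑-distrib-+; *-distribˡ-sum)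
open import Data.Fin using (Fin; zero; suc; toℕ; punchIn)
open import Data.Fin.Properties using (toℕ<n; toℕ-fromℕ<; toℕ-injective; punchInᵢ≢i; punchIn-punchOut)
open import Data.Vec using (Vec; []; _∷_; lookup; replicate; zipWith; _[_]≔_)
open import Data.Vec.Properties using (lookup-zipWith)
open import Data.Vec.Relation.Unary.Any using (Any; here; there)
import Data.Vec.Functional as Vector
open import Data.List using (List; []; _∷_; _++_; map; length; filter; allFin)
open import Data.List.Properties using (length-map; length-tabulate)
open import Data.List.Relation.Unary.All as All using (All; []; _∷_)
open import Data.List.Relation.Unary.All.Properties using (++⁺; map⁺; filter⁺)
open import Data.List.Membership.Propositional using (_∈_)
open import Data.List.Membership.Propositional.Properties using (∈-map⁺; ∈-allFin; ∈-filter⁺)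
open import Data.Product using (Σ; ∃-syntax; _×_; _,_; proj₁; proj₂)
open import Data.Sum using (_⊎_; inj₁; inj₂)
open import Function using (_∘_)
open import Function.Definitions using (Injective)
open import Relation.Nullary using (¬_; Dec; yes; no; contradiction)
open import Relation.Binary using (Setoid)
import Relation.Binary.Construct.On as On
import Relation.Binary.Reasoning.Setoid as SetoidReasoning
open import Relation.Binary.PropositionalEquality

𝟙 : ∀ {a} {A : Set a} → Dec A → ℕ
𝟙 (yes _) = 1
𝟙 (no _) = 0

𝟙-yes : ∀ {a} {A : Set a} (d : Dec A) → A → 𝟙 d ≡ 1
𝟙-yes (yes _) _ = refl
𝟙-yes (no ¬a) a = contradiction a ¬a

𝟙-no : ∀ {a} {A : Set a} (d : Dec A) → ¬ A → 𝟙 d ≡ 0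
𝟙-no (yes a) ¬a = contradiction a ¬a
𝟙-no (no _) _ = refl

length-filter-∷ : ∀ {a p} {A : Set a} {P : A → Set p} (P? : ∀ x → Dec (P x)) x xs →
  length (filter P? (x ∷ xs)) ≡ 𝟙 (P? x) + length (filter P? xs)
length-filter-∷ P? x xs with P? x
... | yes _ = refl
... | no _ = refl

∑-const : ∀ m c → ∑[ i < m ] c ≡ m * c
∑-const zero c = refl
∑-const (suc m) c = cong (c +_) (∑-const m c)

∑-zero : ∀ {m} (g : Fin m → ℕ) → (∀ i → g i ≡ 0) → ∑[ i < m ] g i ≡ 0
∑-zero {m} g g≡0 = trans (sum-cong-≗ g≡0) (sum-replicate-zero m)

∑-𝟙-unique : ∀ {m} {P : Fin m → Set} (P? : ∀ i → Dec (P i)) j → P j → (∀ i → P i → i ≡ j) →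
  ∑[ i < m ] 𝟙 (P? i) ≡ 1
∑-𝟙-unique {suc m} P? j Pj unique = begin
  ∑[ i < suc m ] 𝟙 (P? i)                        ≡⟨ sum-remove {i = j} (𝟙 ∘ P?) ⟩
  𝟙 (P? j) + ∑[ i < m ] 𝟙 (P? (punchIn j i))     ≡⟨ cong₂ _+_ (𝟙-yes (P? j) Pj) (∑-zero _ punched-out) ⟩
  1                                              ∎
  where
  open ≡-Reasoning
  punched-out : ∀ i → 𝟙 (P? (punchIn j i)) ≡ 0
  punched-out i = 𝟙-no (P? (punchIn j i)) (punchInᵢ≢i j i ∘ unique (punchIn j i))

∑<⇒∃< : ∀ {m c} (g : Fin m → ℕ) → ∑[ i < m ] g i < m * c → ∃[ i ] g i < c
∑<⇒∃< {suc m} {c} g ∑g<m*c with g zero <? c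
... | yes g₀<c = zero , g₀<c
... | no g₀≮c =
  let i , gᵢ<c = ∑<⇒∃< (g ∘ suc) (+-cancelˡ-< c _ _ (≤-<-trans (+-monoˡ-≤ _ (≮⇒≥ g₀≮c)) ∑g<m*c))
  in suc i , gᵢ<c

m%n≢0%n⇒2≤n : ∀ m n .{{_ : NonZero n}} → m % n ≢ 0 % n → 2 ≤ n
m%n≢0%n⇒2≤n m 1 m%1≢0 = contradiction (n%1≡0 m) m%1≢0
m%n≢0%n⇒2≤n m (suc (suc _)) _ = s≤s (s≤s z≤n)

m∸1≡suc[m∸2] : ∀ {m} → 2 ≤ m → m ∸ 1 ≡ suc (m ∸ 2)
m∸1≡suc[m∸2] {suc (suc _)} (s≤s (s≤s _)) = refl

module Residues (p : ℕ) .{{_ : NonZero p}} where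

  ≈-setoid : Setoid _ _
  ≈-setoid = On.setoid (setoid ℕ) (_% p)

  open Setoid ≈-setoid public using (_≈_)
  module ≈-Reasoning = SetoidReasoning ≈-setoid

  infix 4 _≈?_
  _≈?_ : ∀ a b → Dec (a ≈ b)
  a ≈? b = a % p ≟ b % p

  𝟙[_≈0] : ℕ → ℕ
  𝟙[ a ≈0] = 𝟙 (a ≈? 0)

  %-≈ : ∀ a → a % p ≈ a
  %-≈ a = m%n%n≡m%n a p

  toℕ-mod : ∀ a → toℕ (a mod p) ≈ a
  toℕ-mod a = trans (cong (_% p) (toℕ-fromℕ< (m%n<n a p))) (%-≈ a)

  +-cong : ∀ {a a′ b b′} → a ≈ a′ → b ≈ b′ → a + b ≈ a′ + b′
  +-cong {a} {a′} {b} {b′} a≈a′ b≈b′ =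
    trans (%-distribˡ-+ a b p) (trans (cong₂ (λ u v → (u + v) % p) a≈a′ b≈b′) (sym (%-distribˡ-+ a′ b′ p)))

  *-cong : ∀ {a a′ b b′} → a ≈ a′ → b ≈ b′ → a * b ≈ a′ * b′
  *-cong {a} {a′} {b} {b′} a≈a′ b≈b′ =
    trans (%-distribˡ-* a b p) (trans (cong₂ (λ u v → (u * v) % p) a≈a′ b≈b′) (sym (%-distribˡ-* a′ b′ p)))

  ^-cong : ∀ {a b} → a ≈ b → ∀ k → a ^ k ≈ b ^ k
  ^-cong a≈b zero = refl
  ^-cong a≈b (suc k) = *-cong a≈b (^-cong a≈b k)

  ≈⇒≡ : ∀ {a b} → a < p → b < p → a ≈ b → a ≡ b
  ≈⇒≡ a<p b<p a≈b = trans (sym (m<n⇒m%n≡m a<p)) (trans a≈b (m<n⇒m%n≡m b<p))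

  toℕ-≈-injective : ∀ {i j : Fin p} → toℕ i ≈ toℕ j → i ≡ j
  toℕ-≈-injective {i} {j} = toℕ-injective ∘ ≈⇒≡ (toℕ<n i) (toℕ<n j)

  ∑-cong-≈ : ∀ {m} {f g : Fin m → ℕ} → (∀ i → f i ≈ g i) → ∑[ i < m ] f i ≈ ∑[ i < m ] g i
  ∑-cong-≈ {zero} f≈g = refl
  ∑-cong-≈ {suc m} f≈g = +-cong (f≈g zero) (∑-cong-≈ (f≈g ∘ suc))

  ∑-≈-single : ∀ {m} (g : Fin (suc m) → ℕ) j → (∀ i → i ≢ j → g i ≈ 0) → ∑[ i < suc m ] g i ≈ g j
  ∑-≈-single {m} g j others≈0 = begin
    ∑[ i < suc m ] g i                       ≡⟨ sum-remove {i = j} g ⟩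
    g j + ∑[ i < m ] g (punchIn j i)         ≈⟨ +-cong {g j} refl (∑-cong-≈ (λ i → others≈0 _ (punchInᵢ≢i j i))) ⟩
    g j + ∑[ i < m ] 0                       ≡⟨ cong (g j +_) (sum-replicate-zero m) ⟩
    g j + 0                                  ≡⟨ +-identityʳ (g j) ⟩
    g j                                      ∎
    where open ≈-Reasoning

  suc[p∸1]≡p : suc (p ∸ 1) ≡ p
  suc[p∸1]≡p = trans (+-comm 1 (p ∸ 1)) (m∸n+n≡m (>-nonZero⁻¹ p))

  +-multiple : ∀ a c → a + p * c ≈ a
  +-multiple a c = %-remove-+ʳ a (m∣m*n c)

  +-negation : ∀ c → c + (p ∸ 1) * c ≈ 0
  +-negation c = trans (cong (λ k → k * c % p) suc[p∸1]≡p) (+-multiple 0 c)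

  +-cancelʳ : ∀ {a b} c → a + c ≈ b + c → a ≈ b
  +-cancelʳ {a} {b} c a+c≈b+c = begin
    a                         ≈⟨ +-multiple a c ⟨
    a + p * c                 ≡⟨ shift a ⟩
    a + c + (p ∸ 1) * c       ≈⟨ +-cong a+c≈b+c refl ⟩
    b + c + (p ∸ 1) * c       ≡⟨ shift b ⟨
    b + p * c                 ≈⟨ +-multiple b c ⟩
    b                         ∎
    where
    open ≈-Reasoning
    shift : ∀ x → x + p * c ≡ x + c + (p ∸ 1) * c
    shift x = trans (cong (λ k → x + k * c) (sym suc[p∸1]≡p)) (sym (+-assoc x c _))

  FermatLittle : Set
  FermatLittle = ∀ r → ¬ r ≈ 0 → r ^ (p ∸ 1) ≈ 1

  fermat-from-residues : (∀ r → r < p → ¬ r ≈ 0 → r ^ (p ∸ 1) ≈ 1) → FermatLittle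
  fermat-from-residues fermat r r≉0 =
    trans (sym (^-cong (%-≈ r) (p ∸ 1))) (fermat (r % p) (m%n<n r p) (r≉0 ∘ trans (sym (%-≈ r))))

  module _ (fermat : FermatLittle) where

    *-inverse : ∀ {z} → ¬ z ≈ 0 → z * z ^ (p ∸ 2) ≈ 1
    *-inverse {z} z≉0 = trans (cong (λ k → z ^ k % p) (sym (m∸1≡suc[m∸2] (m%n≢0%n⇒2≤n z p z≉0)))) (fermat z z≉0)

    *-cancelʳ : ∀ {a b z} → ¬ z ≈ 0 → a * z ≈ b * z → a ≈ b
    *-cancelʳ {a} {b} {z} z≉0 az≈bz = begin
      a                       ≡⟨ *-identityʳ a ⟨
      a * 1                   ≈⟨ *-cong {a} refl (*-inverse z≉0) ⟨
      a * (z * z ^ (p ∸ 2))   ≡⟨ *-assoc a z _ ⟨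
      a * z * z ^ (p ∸ 2)     ≈⟨ *-cong az≈bz refl ⟩
      b * z * z ^ (p ∸ 2)     ≡⟨ *-assoc b z _ ⟩
      b * (z * z ^ (p ∸ 2))   ≈⟨ *-cong {b} refl (*-inverse z≉0) ⟩
      b * 1                   ≡⟨ *-identityʳ b ⟩
      b                       ∎
      where open ≈-Reasoning

module Polynomials (p : ℕ) .{{_ : NonZero p}} where
  open Residues p

  constᴾ : ∀ {n} → ℕ → Poly p n
  constᴾ {n} c = (c mod p , replicate n 0) ∷ []

  varᴾ : ∀ {n} → Fin n → Poly p n
  varᴾ {n} m = (1 mod p , replicate n 0 [ m ]≔ 1) ∷ []

  _*ᴹ_ : ∀ {n} → Monomial p n → Monomial p n → Monomial p n
  (c , e) *ᴹ (c′ , e′) = (toℕ c * toℕ c′) mod p , zipWith _+_ e e′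

  infixl 7 _*ᴾ_
  _*ᴾ_ : ∀ {n} → Poly p n → Poly p n → Poly p n
  [] *ᴾ q = []
  (m ∷ q₁) *ᴾ q₂ = map (m *ᴹ_) q₂ ++ q₁ *ᴾ q₂

  infixr 8 _^ᴾ_
  _^ᴾ_ : ∀ {n} → Poly p n → ℕ → Poly p n
  q ^ᴾ zero = constᴾ 1
  q ^ᴾ suc k = q *ᴾ q ^ᴾ k

  ∑ᴾ : ∀ {n N} → (Fin N → Poly p n) → Poly p n
  ∑ᴾ {N = zero} g = []
  ∑ᴾ {N = suc N} g = g zero ++ ∑ᴾ (g ∘ suc)

  ∏ᴾ : ∀ {n k} → (Fin k → Poly p n) → Poly p n
  ∏ᴾ {k = zero} g = constᴾ 1
  ∏ᴾ {k = suc k} g = g zero *ᴾ ∏ᴾ (g ∘ suc)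

  monoValℕ-replicate-0 : ∀ {n} (x : Point p n) → monoValℕ (replicate n 0) x ≡ 1
  monoValℕ-replicate-0 [] = refl
  monoValℕ-replicate-0 (_ ∷ x) = trans (+-identityʳ _) (monoValℕ-replicate-0 x)

  monoValℕ-unit : ∀ {n} m (x : Point p n) → monoValℕ (replicate n 0 [ m ]≔ 1) x ≡ toℕ (lookup x m)
  monoValℕ-unit zero (x₀ ∷ x) =
    trans (cong (toℕ x₀ ^ 1 *_) (monoValℕ-replicate-0 x)) (trans (*-identityʳ _) (*-identityʳ _))
  monoValℕ-unit (suc m) (_ ∷ x) = trans (+-identityʳ _) (monoValℕ-unit m x)

  monoValℕ-zipWith : ∀ {n} (e e′ : Vec ℕ n) (x : Point p n) →
    monoValℕ (zipWith _+_ e e′) x ≡ monoValℕ e x * monoValℕ e′ x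
  monoValℕ-zipWith [] [] [] = refl
  monoValℕ-zipWith (a ∷ e) (b ∷ e′) (x₀ ∷ x) =
    trans (cong₂ _*_ (^-distribˡ-+-* (toℕ x₀) a b) (monoValℕ-zipWith e e′ x))
          (interchange (toℕ x₀ ^ a) (toℕ x₀ ^ b) (monoValℕ e x) (monoValℕ e′ x))
    where
    interchange : ∀ u v w z → u * v * (w * z) ≡ u * w * (v * z)
    interchange = solve-∀

  monoDeg-replicate-0 : ∀ n → monoDeg (replicate n 0) ≡ 0
  monoDeg-replicate-0 zero = refl
  monoDeg-replicate-0 (suc n) = monoDeg-replicate-0 n

  monoDeg-unit : ∀ {n} (m : Fin n) → monoDeg (replicate n 0 [ m ]≔ 1) ≡ 1
  monoDeg-unit {suc n} zero = cong suc (monoDeg-replicate-0 n)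
  monoDeg-unit (suc m) = monoDeg-unit m

  monoDeg-zipWith : ∀ {n} (e e′ : Vec ℕ n) → monoDeg (zipWith _+_ e e′) ≡ monoDeg e + monoDeg e′
  monoDeg-zipWith [] [] = refl
  monoDeg-zipWith (a ∷ e) (b ∷ e′) =
    trans (cong (a + b +_) (monoDeg-zipWith e e′)) (+-+-interchange a b (monoDeg e) (monoDeg e′))
    where
    +-+-interchange : ∀ u v w z → u + v + (w + z) ≡ u + w + (v + z)
    +-+-interchange = solve-∀

  module _ {n} (x : Point p n) where

    evalℕ-++ : ∀ q₁ q₂ → evalℕ (q₁ ++ q₂) x ≡ evalℕ q₁ x + evalℕ q₂ x
    evalℕ-++ [] q₂ = refl
    evalℕ-++ ((c , e) ∷ q₁) q₂ =
      trans (cong (toℕ c * monoValℕ e x +_) (evalℕ-++ q₁ q₂))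
            (sym (+-assoc (toℕ c * monoValℕ e x) (evalℕ q₁ x) (evalℕ q₂ x)))

    evalℕ-const : ∀ c → evalℕ (constᴾ c) x ≈ c
    evalℕ-const c = trans (cong (_% p) value) (toℕ-mod c)
      where
      value : toℕ (c mod p) * monoValℕ (replicate n 0) x + 0 ≡ toℕ (c mod p)
      value = trans (+-identityʳ _) (trans (cong (toℕ (c mod p) *_) (monoValℕ-replicate-0 x)) (*-identityʳ _))

    evalℕ-var : ∀ m → evalℕ (varᴾ m) x ≈ toℕ (lookup x m)
    evalℕ-var m = begin
      toℕ (1 mod p) * monoValℕ (replicate n 0 [ m ]≔ 1) x + 0   ≡⟨ +-identityʳ _ ⟩
      toℕ (1 mod p) * monoValℕ (replicate n 0 [ m ]≔ 1) x       ≈⟨ *-cong (toℕ-mod 1) (cong (_% p) (monoValℕ-unit m x)) ⟩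
      1 * toℕ (lookup x m)                                      ≡⟨ *-identityˡ _ ⟩
      toℕ (lookup x m)                                          ∎
      where open ≈-Reasoning

    evalℕ-map-*ᴹ : ∀ c e q → evalℕ (map ((c , e) *ᴹ_) q) x ≈ toℕ c * monoValℕ e x * evalℕ q x
    evalℕ-map-*ᴹ c e [] = cong (_% p) (sym (*-zeroʳ (toℕ c * monoValℕ e x)))
    evalℕ-map-*ᴹ c e ((c′ , e′) ∷ q) = begin
      toℕ ((toℕ c * toℕ c′) mod p) * monoValℕ (zipWith _+_ e e′) x + evalℕ (map ((c , e) *ᴹ_) q) x
        ≈⟨ +-cong (*-cong (toℕ-mod _) (cong (_% p) (monoValℕ-zipWith e e′ x))) (evalℕ-map-*ᴹ c e q) ⟩
      toℕ c * toℕ c′ * (monoValℕ e x * monoValℕ e′ x) + toℕ c * monoValℕ e x * evalℕ q x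
        ≡⟨ factor (toℕ c) (toℕ c′) (monoValℕ e x) (monoValℕ e′ x) (evalℕ q x) ⟩
      toℕ c * monoValℕ e x * (toℕ c′ * monoValℕ e′ x + evalℕ q x)
        ∎
      where
      open ≈-Reasoning
      factor : ∀ a a′ u u′ r → a * a′ * (u * u′) + a * u * r ≡ a * u * (a′ * u′ + r)
      factor = solve-∀

    evalℕ-* : ∀ q₁ q₂ → evalℕ (q₁ *ᴾ q₂) x ≈ evalℕ q₁ x * evalℕ q₂ x
    evalℕ-* [] q₂ = refl
    evalℕ-* ((c , e) ∷ q₁) q₂ = begin
      evalℕ (map ((c , e) *ᴹ_) q₂ ++ q₁ *ᴾ q₂) x
        ≡⟨ evalℕ-++ (map ((c , e) *ᴹ_) q₂) (q₁ *ᴾ q₂) ⟩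
      evalℕ (map ((c , e) *ᴹ_) q₂) x + evalℕ (q₁ *ᴾ q₂) x
        ≈⟨ +-cong (evalℕ-map-*ᴹ c e q₂) (evalℕ-* q₁ q₂) ⟩
      toℕ c * monoValℕ e x * evalℕ q₂ x + evalℕ q₁ x * evalℕ q₂ x
        ≡⟨ *-distribʳ-+ (evalℕ q₂ x) (toℕ c * monoValℕ e x) (evalℕ q₁ x) ⟨
      (toℕ c * monoValℕ e x + evalℕ q₁ x) * evalℕ q₂ x
        ∎
      where open ≈-Reasoning

    evalℕ-^ : ∀ q k → evalℕ (q ^ᴾ k) x ≈ evalℕ q x ^ k
    evalℕ-^ q zero = evalℕ-const 1
    evalℕ-^ q (suc k) = trans (evalℕ-* q (q ^ᴾ k)) (*-cong {evalℕ q x} refl (evalℕ-^ q k))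

    evalℕ-∑ : ∀ {N} (g : Fin N → Poly p n) → evalℕ (∑ᴾ g) x ≡ ∑[ i < N ] evalℕ (g i) x
    evalℕ-∑ {zero} g = refl
    evalℕ-∑ {suc N} g = trans (evalℕ-++ (g zero) (∑ᴾ (g ∘ suc))) (cong (evalℕ (g zero) x +_) (evalℕ-∑ (g ∘ suc)))

    evalℕ-∏-≈1 : ∀ {k} (g : Fin k → Poly p n) → (∀ l → evalℕ (g l) x ≈ 1) → evalℕ (∏ᴾ g) x ≈ 1
    evalℕ-∏-≈1 {zero} g _ = evalℕ-const 1
    evalℕ-∏-≈1 {suc k} g all≈1 =
      trans (evalℕ-* (g zero) (∏ᴾ (g ∘ suc))) (*-cong (all≈1 zero) (evalℕ-∏-≈1 (g ∘ suc) (all≈1 ∘ suc)))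

    evalℕ-∏-≈0 : ∀ {k} (g : Fin k → Poly p n) l → evalℕ (g l) x ≈ 0 → evalℕ (∏ᴾ g) x ≈ 0
    evalℕ-∏-≈0 g zero g₀≈0 = trans (evalℕ-* (g zero) (∏ᴾ (g ∘ suc))) (*-cong g₀≈0 refl)
    evalℕ-∏-≈0 g (suc l) gₗ≈0 =
      trans (evalℕ-* (g zero) (∏ᴾ (g ∘ suc)))
            (trans (*-cong {evalℕ (g zero) x} refl (evalℕ-∏-≈0 (g ∘ suc) l gₗ≈0))
                   (cong (_% p) (*-zeroʳ (evalℕ (g zero) x))))

  module _ {n : ℕ} where

    DegLe-mono : ∀ {q : Poly p n} {D D′} → D ≤ D′ → DegLe q D → DegLe q D′
    DegLe-mono D≤D′ = All.map (λ deg≤D → ≤-trans deg≤D D≤D′)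

    DegLe-const : ∀ c → DegLe (constᴾ {n} c) 0
    DegLe-const c = ≤-reflexive (monoDeg-replicate-0 n) ∷ []

    DegLe-var : ∀ m → DegLe (varᴾ {n} m) 1
    DegLe-var m = ≤-reflexive (monoDeg-unit m) ∷ []

    DegLe-* : ∀ {q₁ q₂ : Poly p n} {D₁ D₂} → DegLe q₁ D₁ → DegLe q₂ D₂ → DegLe (q₁ *ᴾ q₂) (D₁ + D₂)
    DegLe-* [] _ = []
    DegLe-* {(_ , e) ∷ _} (e≤D₁ ∷ q₁≤D₁) q₂≤D₂ =
      ++⁺ (map⁺ (All.map (λ {m} m≤D₂ → ≤-trans (≤-reflexive (monoDeg-zipWith e (proj₂ m))) (+-mono-≤ e≤D₁ m≤D₂))
                         q₂≤D₂))
          (DegLe-* q₁≤D₁ q₂≤D₂)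

    DegLe-^ : ∀ {q : Poly p n} {D} → DegLe q D → ∀ k → DegLe (q ^ᴾ k) (k * D)
    DegLe-^ q≤D zero = DegLe-const 1
    DegLe-^ q≤D (suc k) = DegLe-* q≤D (DegLe-^ q≤D k)

    DegLe-∑ : ∀ {N D} (g : Fin N → Poly p n) → (∀ i → DegLe (g i) D) → DegLe (∑ᴾ g) D
    DegLe-∑ {zero} g _ = []
    DegLe-∑ {suc N} g g≤D = ++⁺ (g≤D zero) (DegLe-∑ (g ∘ suc) (g≤D ∘ suc))

    DegLe-∏ : ∀ {k D} (g : Fin k → Poly p n) → (∀ l → DegLe (g l) D) → DegLe (∏ᴾ g) (k * D)
    DegLe-∏ {zero} g _ = DegLe-const 1
    DegLe-∏ {suc k} g g≤D = DegLe-* (g≤D zero) (DegLe-∏ (g ∘ suc) (g≤D ∘ suc))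

module Points (p : ℕ) where

  ∑ᵥ : ∀ {n} → (Point p n → ℕ) → ℕ
  ∑ᵥ {zero} g = g []
  ∑ᵥ {suc n} g = ∑[ a < p ] ∑ᵥ (λ v → g (a ∷ v))

  ∑ᵥ-cong : ∀ {n} {f g : Point p n → ℕ} → (∀ a → f a ≡ g a) → ∑ᵥ f ≡ ∑ᵥ g
  ∑ᵥ-cong {zero} f≡g = f≡g []
  ∑ᵥ-cong {suc n} f≡g = sum-cong-≗ (λ a₀ → ∑ᵥ-cong (λ a → f≡g (a₀ ∷ a)))

  ∑ᵥ-const : ∀ n c → ∑ᵥ {n} (λ _ → c) ≡ p ^ n * c
  ∑ᵥ-const zero c = sym (*-identityˡ c)
  ∑ᵥ-const (suc n) c = begin
    ∑[ a < p ] ∑ᵥ {n} (λ _ → c)   ≡⟨ sum-cong-≗ {p} (λ _ → ∑ᵥ-const n c) ⟩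
    ∑[ a < p ] (p ^ n * c)        ≡⟨ ∑-const p (p ^ n * c) ⟩
    p * (p ^ n * c)               ≡⟨ *-assoc p (p ^ n) c ⟨
    p ^ suc n * c                 ∎
    where open ≡-Reasoning

  ∑ᵥ-distrib-+ : ∀ {n} (f g : Point p n → ℕ) → ∑ᵥ (λ a → f a + g a) ≡ ∑ᵥ f + ∑ᵥ g
  ∑ᵥ-distrib-+ {zero} f g = refl
  ∑ᵥ-distrib-+ {suc n} f g =
    trans (sum-cong-≗ (λ a₀ → ∑ᵥ-distrib-+ (f ∘ (a₀ ∷_)) (g ∘ (a₀ ∷_))))
          (∑-distrib-+ (λ a₀ → ∑ᵥ (f ∘ (a₀ ∷_))) (λ a₀ → ∑ᵥ (g ∘ (a₀ ∷_))))

  ∑-∑ᵥ-comm : ∀ {m n} (g : Fin m → Point p n → ℕ) → ∑[ i < m ] ∑ᵥ (g i) ≡ ∑ᵥ (λ a → ∑[ i < m ] g i a)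
  ∑-∑ᵥ-comm {n = zero} g = refl
  ∑-∑ᵥ-comm {n = suc n} g =
    trans (∑-comm (λ i a₀ → ∑ᵥ (g i ∘ (a₀ ∷_)))) (sum-cong-≗ (λ a₀ → ∑-∑ᵥ-comm (λ i → g i ∘ (a₀ ∷_))))

  ∑ᵥ<⇒∃< : ∀ {n c} (g : Point p n → ℕ) → ∑ᵥ g < p ^ n * c → ∃[ a ] g a < c
  ∑ᵥ<⇒∃< {zero} {c} g g[]<c = [] , subst (g [] <_) (*-identityˡ c) g[]<c
  ∑ᵥ<⇒∃< {suc n} {c} g ∑g<p^[1+n]*c =
    let a₀ , ∑gₐ₀<p^n*c = ∑<⇒∃< (λ a₀ → ∑ᵥ (g ∘ (a₀ ∷_)))
                                 (subst (∑ᵥ g <_) (*-assoc p (p ^ n) c) ∑g<p^[1+n]*c)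
        a , ga<c = ∑ᵥ<⇒∃< (g ∘ (a₀ ∷_)) ∑gₐ₀<p^n*c
    in a₀ ∷ a , ga<c

module Hyperplanes (p : ℕ) .{{_ : NonZero p}} (fermat : Residues.FermatLittle p) where
  open Residues p
  open Points p

  dot : ∀ {n} → Point p n → Point p n → ℕ
  dot {n} a z = ∑[ m < n ] (toℕ (lookup a m) * toℕ (lookup z m))

  Nonzero : ∀ {n} → Point p n → Set
  Nonzero = Any (λ c → ¬ toℕ c ≈ 0)

  unique-root : ∀ {z} → ¬ z ≈ 0 → ∀ c → ∑[ a < p ] 𝟙[ toℕ a * z + c ≈0] ≡ 1
  unique-root {z} z≉0 c = ∑-𝟙-unique (λ a → toℕ a * z + c ≈? 0) root root-is-root unique
    where
    -- -c · z⁻¹, where z⁻¹ = z^(p-2) by Fermat.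
    root : Fin p
    root = ((p ∸ 1) * c * z ^ (p ∸ 2)) mod p

    root-is-root : toℕ root * z + c ≈ 0
    root-is-root = begin
      toℕ root * z + c                        ≈⟨ +-cong (*-cong (toℕ-mod _) refl) refl ⟩
      (p ∸ 1) * c * z ^ (p ∸ 2) * z + c       ≡⟨ regroup (p ∸ 1) c (z ^ (p ∸ 2)) z ⟩
      c + (p ∸ 1) * c * (z * z ^ (p ∸ 2))     ≈⟨ +-cong {c} refl (*-cong {(p ∸ 1) * c} refl (*-inverse fermat z≉0)) ⟩
      c + (p ∸ 1) * c * 1                     ≡⟨ cong (c +_) (*-identityʳ _) ⟩
      c + (p ∸ 1) * c                         ≈⟨ +-negation c ⟩
      0                                       ∎
      where
      open ≈-Reasoning
      regroup : ∀ m c w z → m * c * w * z + c ≡ c + m * c * (z * w)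
      regroup = solve-∀

    unique : ∀ a → toℕ a * z + c ≈ 0 → a ≡ root
    unique a a-is-root = toℕ-≈-injective (*-cancelʳ fermat z≉0 (+-cancelʳ c (trans a-is-root (sym root-is-root))))

  solutions : ∀ {n} → ℕ → Point p n → ℕ
  solutions c z = ∑ᵥ (λ a → 𝟙[ dot a z + c ≈0])

  p*solutions : ∀ {n} {z : Point p n} → Nonzero z → ∀ c → p * solutions c z ≡ p ^ n
  p*solutions {suc n} {z₀ ∷ z} (here z₀≉0) c = cong (p *_) (begin
    solutions c (z₀ ∷ z)
      ≡⟨ sum-cong-≗ {p} (λ a₀ → ∑ᵥ-cong (λ a → cong 𝟙[_≈0] (+-assoc (toℕ a₀ * toℕ z₀) (dot a z) c))) ⟩
    ∑[ a₀ < p ] ∑ᵥ (λ a → 𝟙[ toℕ a₀ * toℕ z₀ + (dot a z + c) ≈0])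
      ≡⟨ ∑-∑ᵥ-comm {p} (λ a₀ a → 𝟙[ toℕ a₀ * toℕ z₀ + (dot a z + c) ≈0]) ⟩
    ∑ᵥ (λ a → ∑[ a₀ < p ] 𝟙[ toℕ a₀ * toℕ z₀ + (dot a z + c) ≈0])
      ≡⟨ ∑ᵥ-cong (λ a → unique-root z₀≉0 (dot a z + c)) ⟩
    ∑ᵥ {n} (λ _ → 1)
      ≡⟨ trans (∑ᵥ-const n 1) (*-identityʳ (p ^ n)) ⟩
    p ^ n
      ∎)
    where open ≡-Reasoning
  p*solutions {suc n} {z₀ ∷ z} (there z≢0) c = begin
    p * solutions c (z₀ ∷ z)
      ≡⟨ cong (p *_) (sum-cong-≗ {p} (λ a₀ → ∑ᵥ-cong (λ a → cong 𝟙[_≈0] (rotate (toℕ a₀ * toℕ z₀) (dot a z) c)))) ⟩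
    p * ∑[ a₀ < p ] solutions (toℕ a₀ * toℕ z₀ + c) z
      ≡⟨ *-distribˡ-sum {p} p (λ a₀ → solutions (toℕ a₀ * toℕ z₀ + c) z) ⟩
    ∑[ a₀ < p ] (p * solutions (toℕ a₀ * toℕ z₀ + c) z)
      ≡⟨ sum-cong-≗ {p} (λ a₀ → p*solutions z≢0 (toℕ a₀ * toℕ z₀ + c)) ⟩
    ∑[ a₀ < p ] (p ^ n)
      ≡⟨ ∑-const p (p ^ n) ⟩
    p ^ suc n
      ∎
    where
    open ≡-Reasoning
    rotate : ∀ u v w → u + v + w ≡ v + (u + w)
    rotate = solve-∀

  annihilated : ∀ {n} → Point p n → List (Point p n) → List (Point p n)
  annihilated a = filter (λ z → dot a z ≈? 0)

  p*∑ᵥ-annihilated : ∀ {n} {L : List (Point p n)} → All Nonzero L →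
    p * ∑ᵥ (λ a → length (annihilated a L)) ≡ length L * p ^ n
  p*∑ᵥ-annihilated {n} [] = trans (cong (p *_) (trans (∑ᵥ-const n 0) (*-zeroʳ (p ^ n)))) (*-zeroʳ p)
  p*∑ᵥ-annihilated {n} {z ∷ L} (z≢0 ∷ L≢0) = begin
    p * ∑ᵥ (λ a → length (annihilated a (z ∷ L)))
      ≡⟨ cong (p *_) (∑ᵥ-cong (λ a → length-filter-∷ (λ z → dot a z ≈? 0) z L)) ⟩
    p * ∑ᵥ (λ a → 𝟙[ dot a z ≈0] + length (annihilated a L))
      ≡⟨ cong (p *_) (∑ᵥ-distrib-+ (λ a → 𝟙[ dot a z ≈0]) (λ a → length (annihilated a L))) ⟩
    p * (∑ᵥ (λ a → 𝟙[ dot a z ≈0]) + ∑ᵥ (λ a → length (annihilated a L)))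
      ≡⟨ *-distribˡ-+ p _ _ ⟩
    p * ∑ᵥ (λ a → 𝟙[ dot a z ≈0]) + p * ∑ᵥ (λ a → length (annihilated a L))
      ≡⟨ cong₂ _+_ (trans (cong (p *_) (∑ᵥ-cong (λ a → cong 𝟙[_≈0] (sym (+-identityʳ (dot a z))))))
                          (p*solutions z≢0 0))
                   (p*∑ᵥ-annihilated L≢0) ⟩
    p ^ n + length L * p ^ n
      ∎
    where open ≡-Reasoning

  few-annihilated : ∀ {n k} {L : List (Point p n)} → All Nonzero L → length L < p ^ suc k →
    ∃[ a ] length (annihilated a L) < p ^ k
  few-annihilated {n} {k} {L} L≢0 L<p^[1+k] = ∑ᵥ<⇒∃< _ (*-cancelˡ-< p _ _ (begin-strict
    p * ∑ᵥ (λ a → length (annihilated a L))    ≡⟨ p*∑ᵥ-annihilated L≢0 ⟩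
    length L * p ^ n                           <⟨ *-monoˡ-< (p ^ n) {{m^n≢0 p n}} L<p^[1+k] ⟩
    p * p ^ k * p ^ n                          ≡⟨ swap p (p ^ k) (p ^ n) ⟩
    p * (p ^ n * p ^ k)                        ∎))
    where
    open ≤-Reasoning
    swap : ∀ u v w → u * v * w ≡ u * (w * v)
    swap = solve-∀

  Separates : ∀ {n k} → (Fin k → Point p n) → Point p n → Set
  Separates as z = ∃[ l ] ¬ dot (as l) z ≈ 0

  separators : ∀ {n} k (L : List (Point p n)) → All Nonzero L → length L < p ^ k →
    Σ (Fin k → Point p n) (λ as → All (Separates as) L)
  separators zero [] _ _ = (λ ()) , []
  separators zero (_ ∷ _) _ (s≤s ())
  separators (suc k) L L≢0 L<p^[1+k] =
    let a , few = few-annihilated {k = k} L≢0 L<p^[1+k]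
        as , separated = separators k (annihilated a L) (filter⁺ _ L≢0) few
    in a Vector.∷ as , All.tabulate (extend a as separated)
    where
    extend : ∀ a as → All (Separates as) (annihilated a L) → ∀ {z} → z ∈ L → Separates (a Vector.∷ as) z
    extend a as separated {z} z∈L with dot a z ≈? 0
    ... | yes a·z≈0 = let l , sep = All.lookup separated (∈-filter⁺ (λ z → dot a z ≈? 0) z∈L a·z≈0) in suc l , sep
    ... | no a·z≉0 = zero , a·z≉0

module Interpolation (p : ℕ) .{{_ : NonZero p}} (fermat : Residues.FermatLittle p) where
  open Residues p
  open Polynomials p
  open Hyperplanes p fermat

  -- Subtraction in 𝔽ₚ, written as b + (p - 1) c since ℕ subtraction truncates.
  _⊖_ : ∀ {n} → Point p n → Point p n → Point p n
  _⊖_ = zipWith (λ b c → (toℕ b + (p ∸ 1) * toℕ c) mod p)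

  toℕ-lookup-⊖ : ∀ {n} (y x : Point p n) m → toℕ (lookup (y ⊖ x) m) ≈ toℕ (lookup y m) + (p ∸ 1) * toℕ (lookup x m)
  toℕ-lookup-⊖ y x m = trans (cong (λ c → toℕ c % p) (lookup-zipWith _ m y x)) (toℕ-mod _)

  ⊖-nonzero : ∀ {n} (y x : Point p n) → y ≢ x → Nonzero (y ⊖ x)
  ⊖-nonzero [] [] []≢[] = contradiction refl []≢[]
  ⊖-nonzero (y₀ ∷ y) (x₀ ∷ x) y≢x with toℕ ((toℕ y₀ + (p ∸ 1) * toℕ x₀) mod p) ≈? 0
  ... | no y₀-x₀≉0 = here y₀-x₀≉0
  ... | yes y₀-x₀≈0 = there (⊖-nonzero y x (y≢x ∘ cong₂ _∷_ y₀≡x₀))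
    where
    y₀≡x₀ : y₀ ≡ x₀
    y₀≡x₀ = toℕ-≈-injective (+-cancelʳ ((p ∸ 1) * toℕ x₀)
              (trans (sym (toℕ-mod _)) (trans y₀-x₀≈0 (sym (+-negation (toℕ x₀))))))

  dot-⊖-self : ∀ {n} (a x : Point p n) → dot a (x ⊖ x) ≈ 0
  dot-⊖-self {n} a x = begin
    dot a (x ⊖ x)                                                        ≈⟨ ∑-cong-≈ term≈0 ⟩
    ∑[ m < n ] 0                                                         ≡⟨ sum-replicate-zero n ⟩
    0                                                                    ∎
    where
    open ≈-Reasoning
    term≈0 : ∀ m → toℕ (lookup a m) * toℕ (lookup (x ⊖ x) m) ≈ 0
    term≈0 m = trans (*-cong {toℕ (lookup a m)} refl (trans (toℕ-lookup-⊖ x x m) (+-negation _)))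
                     (cong (_% p) (*-zeroʳ (toℕ (lookup a m))))

  coordinateᴾ : ∀ {n} → Point p n → Fin n → Poly p n
  coordinateᴾ x m = varᴾ m ++ constᴾ ((p ∸ 1) * toℕ (lookup x m))

  evalℕ-coordinate : ∀ {n} (x y : Point p n) m → evalℕ (coordinateᴾ x m) y ≈ toℕ (lookup (y ⊖ x) m)
  evalℕ-coordinate x y m =
    trans (cong (_% p) (evalℕ-++ y (varᴾ m) (constᴾ ((p ∸ 1) * toℕ (lookup x m)))))
          (trans (+-cong (evalℕ-var y m) (evalℕ-const y ((p ∸ 1) * toℕ (lookup x m)))) (sym (toℕ-lookup-⊖ y x m)))

  linearᴾ : ∀ {n} → Point p n → Point p n → Poly p n
  linearᴾ a x = ∑ᴾ (λ m → constᴾ (toℕ (lookup a m)) *ᴾ coordinateᴾ x m)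

  evalℕ-linear : ∀ {n} (a x y : Point p n) → evalℕ (linearᴾ a x) y ≈ dot a (y ⊖ x)
  evalℕ-linear a x y =
    trans (cong (_% p) (evalℕ-∑ y (λ m → constᴾ (toℕ (lookup a m)) *ᴾ coordinateᴾ x m))) (∑-cong-≈ term)
    where
    term : ∀ m → evalℕ (constᴾ (toℕ (lookup a m)) *ᴾ coordinateᴾ x m) y ≈ toℕ (lookup a m) * toℕ (lookup (y ⊖ x) m)
    term m = trans (evalℕ-* y (constᴾ (toℕ (lookup a m))) (coordinateᴾ x m))
                   (*-cong (evalℕ-const y (toℕ (lookup a m))) (evalℕ-coordinate x y m))

  DegLe-linear : ∀ {n} (a x : Point p n) → DegLe (linearᴾ a x) 1
  DegLe-linear a x = DegLe-∑ _ (λ m → DegLe-* (DegLe-const _) (++⁺ (DegLe-var m) (DegLe-mono z≤n (DegLe-const _))))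

  -- 1 - (a·(y - x))^(p-1), which by Fermat is the indicator of the hyperplane a·(y - x) = 0.
  indicatorᴾ : ∀ {n} → Point p n → Point p n → Poly p n
  indicatorᴾ a x = constᴾ 1 ++ constᴾ (p ∸ 1) *ᴾ linearᴾ a x ^ᴾ (p ∸ 1)

  evalℕ-indicator : ∀ {n} (a x y : Point p n) → evalℕ (indicatorᴾ a x) y ≈ 1 + (p ∸ 1) * dot a (y ⊖ x) ^ (p ∸ 1)
  evalℕ-indicator a x y =
    trans (cong (_% p) (evalℕ-++ y (constᴾ 1) (constᴾ (p ∸ 1) *ᴾ linearᴾ a x ^ᴾ (p ∸ 1))))
          (+-cong (evalℕ-const y 1)
                  (trans (evalℕ-* y (constᴾ (p ∸ 1)) (linearᴾ a x ^ᴾ (p ∸ 1)))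
                         (*-cong (evalℕ-const y (p ∸ 1))
                                 (trans (evalℕ-^ y (linearᴾ a x) (p ∸ 1)) (^-cong (evalℕ-linear a x y) (p ∸ 1))))))

  indicator-≈0 : ∀ v → ¬ v ≈ 0 → 1 + (p ∸ 1) * v ^ (p ∸ 1) ≈ 0
  indicator-≈0 v v≉0 = trans (+-cong {1} refl (*-cong {p ∸ 1} refl (fermat v v≉0))) (+-negation 1)

  indicator-≈1 : ∀ v → v ≈ 0 → 1 + (p ∸ 1) * v ^ (p ∸ 1) ≈ 1
  indicator-≈1 v v≈0 = trans (+-cong {1} refl (power≈0 (p ∸ 1))) (cong (_% p) (+-identityʳ 1))
    where
    power≈0 : ∀ k → k * v ^ k ≈ 0
    power≈0 zero = refl
    power≈0 (suc k) = trans (*-cong {suc k} refl (^-cong v≈0 (suc k))) (cong (_% p) (*-zeroʳ (suc k)))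

  DegLe-indicator : ∀ {n} (a x : Point p n) → DegLe (indicatorᴾ a x) (p ∸ 1)
  DegLe-indicator a x =
    ++⁺ (DegLe-mono z≤n (DegLe-const 1))
        (DegLe-mono (≤-reflexive (*-identityʳ (p ∸ 1))) (DegLe-* (DegLe-const (p ∸ 1)) (DegLe-^ (DegLe-linear a x) (p ∸ 1))))

  bumpᴾ : ∀ {n k} → (Fin k → Point p n) → Point p n → Poly p n
  bumpᴾ as x = ∏ᴾ (λ l → indicatorᴾ (as l) x)

  bump-centre : ∀ {n k} (as : Fin k → Point p n) x → evalℕ (bumpᴾ as x) x ≈ 1
  bump-centre as x = evalℕ-∏-≈1 x _ (λ l →
    trans (evalℕ-indicator (as l) x x) (indicator-≈1 _ (dot-⊖-self (as l) x)))

  bump-separated : ∀ {n k} (as : Fin k → Point p n) x y → Separates as (y ⊖ x) → evalℕ (bumpᴾ as x) y ≈ 0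
  bump-separated as x y (l , as[l]·[y-x]≉0) = evalℕ-∏-≈0 y _ l
    (trans (evalℕ-indicator (as l) x y) (indicator-≈0 _ as[l]·[y-x]≉0))

  DegLe-bump : ∀ {n k} (as : Fin k → Point p n) x → DegLe (bumpᴾ as x) ((p ∸ 1) * k)
  DegLe-bump {k = k} as x = DegLe-mono (≤-reflexive (*-comm k (p ∸ 1))) (DegLe-∏ _ (λ l → DegLe-indicator (as l) x))

  separating-family : ∀ {n N d} → N ≤ p ^ d → (X : Fin N → Point p n) → Injective _≡_ _≡_ X →
    ∀ i → Σ (Fin d → Point p n) (λ as → ∀ j → j ≢ i → Separates as (X j ⊖ X i))
  separating-family {n} {suc N} {d} N<p^d X X-injective i =
    let as , separated = separators d differences differences-nonzero differences<p^d
    in as , λ j j≢i → All.lookup separated (∈-differences j j≢i)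
    where
    differences : List (Point p n)
    differences = map (λ j → X (punchIn i j) ⊖ X i) (allFin N)

    differences-nonzero : All Nonzero differences
    differences-nonzero = map⁺ (All.universal (λ j → ⊖-nonzero _ _ (punchInᵢ≢i i j ∘ X-injective)) (allFin N))

    differences<p^d : length differences < p ^ d
    differences<p^d = subst (_< p ^ d) (sym (trans (length-map _ (allFin N)) (length-tabulate _))) N<p^d

    ∈-differences : ∀ j → j ≢ i → X j ⊖ X i ∈ differences
    ∈-differences j j≢i = subst (λ j′ → X j′ ⊖ X i ∈ differences) (punchIn-punchOut (j≢i ∘ sym))
                            (∈-map⁺ (λ j → X (punchIn i j) ⊖ X i) (∈-allFin _))

  interpolation : ∀ {n N d} → N ≤ p ^ d → (X : Fin N → Point p n) → Injective _≡_ _≡_ X → (f : Fin N → Fin p) →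
    Σ (Poly p n) (λ q → DegLe q ((p ∸ 1) * d) × (∀ i → EvalEq p q (X i) (f i)))
  interpolation {n} {zero} _ X _ f = [] , [] , λ ()
  interpolation {n} {suc N} {d} N≤p^d X X-injective f = q , DegLe-q , q-interpolates
    where
    as : Fin (suc N) → Fin d → Point p n
    as i = proj₁ (separating-family N≤p^d X X-injective i)

    separated : ∀ i j → j ≢ i → Separates (as i) (X j ⊖ X i)
    separated i = proj₂ (separating-family N≤p^d X X-injective i)

    term : Fin (suc N) → Poly p n
    term i = constᴾ (toℕ (f i)) *ᴾ bumpᴾ (as i) (X i)

    q : Poly p n
    q = ∑ᴾ term

    DegLe-q : DegLe q ((p ∸ 1) * d)
    DegLe-q = DegLe-∑ term (λ i → DegLe-* (DegLe-const _) (DegLe-bump (as i) (X i)))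

    evalℕ-term : ∀ i j → evalℕ (term i) (X j) ≈ toℕ (f i) * evalℕ (bumpᴾ (as i) (X i)) (X j)
    evalℕ-term i j = trans (evalℕ-* (X j) (constᴾ (toℕ (f i))) (bumpᴾ (as i) (X i)))
                           (*-cong (evalℕ-const (X j) (toℕ (f i))) refl)

    q-interpolates : ∀ j → EvalEq p q (X j) (f j)
    q-interpolates j = trans (begin
      evalℕ q (X j)                                               ≡⟨ evalℕ-∑ (X j) term ⟩
      ∑[ i < suc N ] evalℕ (term i) (X j)                         ≈⟨ ∑-≈-single _ j other-terms≈0 ⟩
      evalℕ (term j) (X j)                                        ≈⟨ evalℕ-term j j ⟩
      toℕ (f j) * evalℕ (bumpᴾ (as j) (X j)) (X j)                ≈⟨ *-cong {toℕ (f j)} refl (bump-centre (as j) (X j)) ⟩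
      toℕ (f j) * 1                                               ≡⟨ *-identityʳ _ ⟩
      toℕ (f j)                                                   ∎) (m<n⇒m%n≡m (toℕ<n (f j)))
      where
      open ≈-Reasoning
      other-terms≈0 : ∀ i → i ≢ j → evalℕ (term i) (X j) ≈ 0
      other-terms≈0 i i≢j =
        trans (evalℕ-term i j)
              (trans (*-cong {toℕ (f i)} refl (bump-separated (as i) (X i) (X j) (separated i j (i≢j ∘ sym))))
                     (cong (_% p) (*-zeroʳ (toℕ (f i)))))

fermat-2or3 : ∀ {p} .{{_ : NonZero p}} → p ≡ 2 ⊎ p ≡ 3 → Residues.FermatLittle p
fermat-2or3 (inj₁ refl) = Residues.fermat-from-residues 2 λ where
  0 _ 0≉0 → contradiction refl 0≉0
  1 _ _ → refl
  (suc (suc _)) (s≤s (s≤s ())) _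
fermat-2or3 (inj₂ refl) = Residues.fermat-from-residues 3 λ where
  0 _ 0≉0 → contradiction refl 0≉0
  1 _ _ → refl
  2 _ _ → refl
  (suc (suc (suc _))) (s≤s (s≤s (s≤s ()))) _

lemma2p13 : (p : ℕ) .{{_ : NonZero p}} → (p ≡ 2 ⊎ p ≡ 3) →
    (d : ℕ) → 1 < d → (n : ℕ) →
    (X : Fin (p ^ d ∸ 1) → Point p n) →
    (∀ i j → X i ≡ X j → i ≡ j) →
    (f : Fin (p ^ d ∸ 1) → Fin p) →
    Σ (Poly p n) (λ q → DegLe q ((p ∸ 1) * d) × (∀ i → EvalEq p q (X i) (f i)))
lemma2p13 p p∈23 d _ n X X-injective f = interpolation (m∸n≤m (p ^ d) 1) X (λ {i} {j} → X-injective i j) f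
  where open Interpolation p (fermat-2or3 p∈23)
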